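{- For every integer $n\geq 0$ and every integer $j\geq 1$, $$\sum_{k=0}^n \binom{n}{k}(\sqrt{5}F_{2j})^{n-k}F_{2kj}\,B_{n-k} = \frac{n}{2}F_{2j}\bigl(L_{2j(n-1)} - \sqrt{5}F_{2j(n-1)}\bigr).$$
   Context: $B_n$ denotes the $n$-th Bernoulli number, defined by $\sum_{n\ge0}B_n\frac{z^n}{n!}=\frac{z}{e^z-1}$ (so $B_1=-1/2$). $F_n$ and $L_n$ are the Fibonacci and Lucas numbers: $F_0=0,F_1=1$, $L_0=2,L_1=1$, and $X_n=X_{n-1}+X_{n-2}$ for $n\ge2$. For $n=0$ the right-hand side, which carries the factor $n$, is interpreted as $0$. -}

module Defs where

open import Data.Nat as ℕ using (ℕ; zero; suc)
open import Data.Nat.Combinatorics using (_C_)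
open import Data.Integer using (+_)
open import Data.Rational as ℚ using (ℚ; 0ℚ; 1ℚ)
open import Data.Bool using (true; false)



fib : ℕ → ℕ
fib 0 = 0
fib 1 = 1
fib (suc (suc n)) = fib (suc n) ℕ.+ fib n

lucas : ℕ → ℕ
lucas 0 = 2
lucas 1 = 1
lucas (suc (suc n)) = lucas (suc n) ℕ.+ lucas n

ℕ→ℚ : ℕ → ℚ
ℕ→ℚ n = + n ℚ./ 1

sumℚ : ℕ → (ℕ → ℚ) → ℚ
sumℚ zero f = f 0
sumℚ (suc n) f = sumℚ n f ℚ.+ f (suc n)

-- Bernoulli numbers, B_1 = -1/2, defined by the coefficient recurrence equivalent to
-- z/(e^z-1) = Σ B_n z^n/n!, i.e. B_0 = 1 and Σ_{k=0}^{m} C(m+1,k) B_k = 0 for m ≥ 1.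
-- bernList n = [B_0, ..., B_n] (as a function on indices ≤ n, default 0 elsewhere).
bernTable : ℕ → (ℕ → ℚ)
bernTable zero k = 1ℚ
bernTable (suc m) k with k ℕ.≤ᵇ m
... | true = bernTable m k
... | false =
  ℚ.- ((sumℚ m (λ i → ℕ→ℚ ((suc (suc m)) C i) ℚ.* bernTable m i)) ℚ.* (+ 1 ℚ./ suc (suc m)))

bernoulli : ℕ → ℚ
bernoulli n = bernTable n n

record ℚ√5 : Set where
  constructor _+_√5
  field
    re : ℚ
    im : ℚ
open ℚ√5 public

infixl 6 _⊕_
infixl 7 _⊗_ _•_

_⊕_ : ℚ√5 → ℚ√5 → ℚ√5
(a + b √5) ⊕ (c + d √5) = (a ℚ.+ c) + (b ℚ.+ d) √5

_⊗_ : ℚ√5 → ℚ√5 → ℚ√5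
(a + b √5) ⊗ (c + d √5) =
  (a ℚ.* c ℚ.+ ℕ→ℚ 5 ℚ.* (b ℚ.* d)) + (a ℚ.* d ℚ.+ b ℚ.* c) √5

_•_ : ℚ → ℚ√5 → ℚ√5
r • (a + b √5) = (r ℚ.* a) + (r ℚ.* b) √5

zero√5 one√5 sqrt5 : ℚ√5
zero√5 = 0ℚ + 0ℚ √5
one√5 = 1ℚ + 0ℚ √5
sqrt5 = 0ℚ + 1ℚ √5

_^√5_ : ℚ√5 → ℕ → ℚ√5
x ^√5 zero = one√5
x ^√5 suc n = x ⊗ (x ^√5 n)

sum√5 : ℕ → (ℕ → ℚ√5) → ℚ√5
sum√5 zero f = f 0
sum√5 (suc n) f = sum√5 n f ⊕ f (suc n)

lhs : ℕ → ℕ → ℚ√5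
lhs n j = sum√5 n (λ k →
  (ℕ→ℚ (n C k) ℚ.* ℕ→ℚ (fib (2 ℕ.* k ℕ.* j)) ℚ.* bernoulli (n ℕ.∸ k))
    • ((ℕ→ℚ (fib (2 ℕ.* j)) • sqrt5) ^√5 (n ℕ.∸ k)))

-- RHS: (n/2) F_{2j} (L_{2j(n-1)} - √5 F_{2j(n-1)}), interpreted as 0 for n = 0
rhs : ℕ → ℕ → ℚ√5
rhs zero j = zero√5
rhs (suc m) j =
  ((+ suc m ℚ./ 2) ℚ.* ℕ→ℚ (fib (2 ℕ.* j)))
    • (ℕ→ℚ (lucas (2 ℕ.* j ℕ.* m)) + ℚ.- ℕ→ℚ (fib (2 ℕ.* j ℕ.* m)) √5)

-- Let φ, ψ = (1 ± √5)/2, X = F_{2j} √5 and β = ψ^{2j}. Binet's formula √5 F_m = φ^m − ψ^m gives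
-- β + X = φ^{2j}, hence √5 F_{2kj} = (β + X)^k − β^k, so √5 times the left-hand side is
-- Σ_k C(n,k) B_{n−k} X^{n−k} ((β + X)^k − β^k) = X^n (B_n(x + 1) − B_n(x)) at x = β/X, where
-- B_n(x) = Σ_k C(n,k) B_{n−k} x^k. Expanding (x + 1)^k binomially and using trinomial revision, the
-- coefficient of x^i in B_n(x + 1) − B_n(x) is C(n,i) times Σ_l C(n−i,l) B_l − B_{n−i}, which the defining
-- recurrence of the Bernoulli numbers evaluates to [n − i = 1]. So the sum is n X β^{n−1}, and Binet's
-- formula for ψ^{2j(n−1)} turns this into √5 times the right-hand side.

module Submission where

open import Defs
open import Data.Nat using (ℕ; _≤_)
open import Relation.Binary.PropositionalEquality using (_≡_)

open import Level using (0ℓ)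
open import Data.Bool using (true; false; T)
open import Data.Empty using (⊥-elim)
open import Data.Maybe using (Maybe; just; nothing)
open import Data.List using (_∷_; [])
open import Data.Product using (_×_; _,_; proj₁; proj₂)
open import Data.Nat as ℕ using (zero; suc; _<_; _>_; z≤n; s≤s; _!)
import Data.Nat.Properties as ℕP
open import Data.Nat.Combinatorics
open import Data.Nat.DivMod using (m/n*n≡m)
open import Data.Integer as ℤ using (+_)
import Data.Integer.Properties as ℤP
open import Data.Rational as ℚ using (ℚ; 0ℚ; 1ℚ; ½)
import Data.Rational.Properties as ℚP
open import Data.Rational.Unnormalised as ℚᵘ using (mkℚᵘ; *≡*)
import Data.Rational.Unnormalised.Properties as ℚᵘP
open import Relation.Nullary using (Dec; yes; no)
open import Function using (_∘_)
open import Relation.Nullary.Decidable using (dec⇒maybe)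
import Relation.Binary.PropositionalEquality as ≡
open import Relation.Binary.PropositionalEquality
  using (_≢_; refl; sym; trans; cong; cong₂; subst; module ≡-Reasoning)
open import Algebra.Bundles using (CommutativeRing)
open import Algebra.Structures {A = ℚ√5} _≡_ using (IsCommutativeRing)
open import Tactic.RingSolver using (solve)
import Tactic.RingSolver.Core.AlmostCommutativeRing as ACR
open import Data.Nat.Tactic.RingSolver using () renaming (solve-∀ to ℕ-solve)
open import Data.Integer.Tactic.RingSolver using () renaming (solve-∀ to ℤ-solve)


-- The solver can only cancel constant coefficients such as 0ℚ with a working zero test.
ℚ-ring : ACR.AlmostCommutativeRing 0ℓ 0ℓ
ℚ-ring = ACR.fromCommutativeRing ℚP.+-*-commutativeRing isZero?
  where
  isZero? : ∀ x → Maybe (0ℚ ≡ x)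
  isZero? x = dec⇒maybe (0ℚ ℚP.≟ x)

toℚᵘ-/ : ∀ a k → ℚ.toℚᵘ (+ a ℚ./ suc k) ℚᵘ.≃ mkℚᵘ (+ a) k
toℚᵘ-/ a k = ℚP.toℚᵘ-fromℚᵘ (mkℚᵘ (+ a) k)

ℕ→ℚ-+ : ∀ a b → ℕ→ℚ (a ℕ.+ b) ≡ ℕ→ℚ a ℚ.+ ℕ→ℚ b
ℕ→ℚ-+ a b = ℚP.toℚᵘ-injective (begin
  ℚ.toℚᵘ (ℕ→ℚ (a ℕ.+ b))               ≈⟨ toℚᵘ-/ (a ℕ.+ b) 0 ⟩
  mkℚᵘ (+ (a ℕ.+ b)) 0                   ≈⟨ *≡* (trans (cong (ℤ._* + 1) (ℤP.pos-+ a b)) (lemma (+ a) (+ b))) ⟩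
  mkℚᵘ (+ a) 0 ℚᵘ.+ mkℚᵘ (+ b) 0         ≈⟨ ℚᵘP.+-cong (toℚᵘ-/ a 0) (toℚᵘ-/ b 0) ⟨
  ℚ.toℚᵘ (ℕ→ℚ a) ℚᵘ.+ ℚ.toℚᵘ (ℕ→ℚ b)   ≈⟨ ℚP.toℚᵘ-homo-+ (ℕ→ℚ a) (ℕ→ℚ b) ⟨
  ℚ.toℚᵘ (ℕ→ℚ a ℚ.+ ℕ→ℚ b)             ∎)
  where
  open ℚᵘP.≃-Reasoning
  lemma : ∀ x y → (x ℤ.+ y) ℤ.* + 1 ≡ (x ℤ.* + 1 ℤ.+ y ℤ.* + 1) ℤ.* + 1
  lemma = ℤ-solve

ℕ→ℚ-* : ∀ a b → ℕ→ℚ (a ℕ.* b) ≡ ℕ→ℚ a ℚ.* ℕ→ℚ b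
ℕ→ℚ-* a b = ℚP.toℚᵘ-injective (begin
  ℚ.toℚᵘ (ℕ→ℚ (a ℕ.* b))               ≈⟨ toℚᵘ-/ (a ℕ.* b) 0 ⟩
  mkℚᵘ (+ (a ℕ.* b)) 0                   ≈⟨ *≡* (cong (ℤ._* + 1) (ℤP.pos-* a b)) ⟩
  mkℚᵘ (+ a) 0 ℚᵘ.* mkℚᵘ (+ b) 0         ≈⟨ ℚᵘP.*-cong (toℚᵘ-/ a 0) (toℚᵘ-/ b 0) ⟨
  ℚ.toℚᵘ (ℕ→ℚ a) ℚᵘ.* ℚ.toℚᵘ (ℕ→ℚ b)   ≈⟨ ℚP.toℚᵘ-homo-* (ℕ→ℚ a) (ℕ→ℚ b) ⟨
  ℚ.toℚᵘ (ℕ→ℚ a ℚ.* ℕ→ℚ b)             ∎)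
  where open ℚᵘP.≃-Reasoning

a/n*n≡a : ∀ a k → (+ a ℚ./ suc k) ℚ.* ℕ→ℚ (suc k) ≡ ℕ→ℚ a
a/n*n≡a a k = ℚP.toℚᵘ-injective (begin
  ℚ.toℚᵘ ((+ a ℚ./ suc k) ℚ.* ℕ→ℚ (suc k))          ≈⟨ ℚP.toℚᵘ-homo-* (+ a ℚ./ suc k) (ℕ→ℚ (suc k)) ⟩
  ℚ.toℚᵘ (+ a ℚ./ suc k) ℚᵘ.* ℚ.toℚᵘ (ℕ→ℚ (suc k)) ≈⟨ ℚᵘP.*-cong (toℚᵘ-/ a k) (toℚᵘ-/ (suc k) 0) ⟩
  mkℚᵘ (+ a) k ℚᵘ.* mkℚᵘ (+ suc k) 0                 ≈⟨ *≡* (trans (ℤP.*-identityʳ _) (cong (λ z → + a ℤ.* + suc z) (sym (ℕP.*-identityʳ k)))) ⟩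
  mkℚᵘ (+ a) 0                                       ≈⟨ toℚᵘ-/ a 0 ⟨
  ℚ.toℚᵘ (ℕ→ℚ a)                                    ∎)
  where open ℚᵘP.≃-Reasoning

open ≡-Reasoning

-- The ring ℚ(√5)

infix 8 ⊖_

⊖_ : ℚ√5 → ℚ√5
⊖ (a + b √5) = (ℚ.- a) + (ℚ.- b) √5

⊕-assoc : ∀ x y z → (x ⊕ y) ⊕ z ≡ x ⊕ (y ⊕ z)
⊕-assoc (a + b √5) (c + d √5) (e + f √5) = cong₂ _+_√5 (ℚP.+-assoc a c e) (ℚP.+-assoc b d f)

⊕-comm : ∀ x y → x ⊕ y ≡ y ⊕ x
⊕-comm (a + b √5) (c + d √5) = cong₂ _+_√5 (ℚP.+-comm a c) (ℚP.+-comm b d)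

⊕-identityˡ : ∀ x → zero√5 ⊕ x ≡ x
⊕-identityˡ (a + b √5) = cong₂ _+_√5 (ℚP.+-identityˡ a) (ℚP.+-identityˡ b)

⊖-inverseˡ : ∀ x → ⊖ x ⊕ x ≡ zero√5
⊖-inverseˡ (a + b √5) = cong₂ _+_√5 (ℚP.+-inverseˡ a) (ℚP.+-inverseˡ b)

⊗-assoc : ∀ x y z → (x ⊗ y) ⊗ z ≡ x ⊗ (y ⊗ z)
⊗-assoc (a + b √5) (c + d √5) (e + f √5) = cong₂ _+_√5 re-assoc im-assoc
  where
  re-assoc : (a ℚ.* c ℚ.+ ℕ→ℚ 5 ℚ.* (b ℚ.* d)) ℚ.* e ℚ.+ ℕ→ℚ 5 ℚ.* ((a ℚ.* d ℚ.+ b ℚ.* c) ℚ.* f)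
           ≡ a ℚ.* (c ℚ.* e ℚ.+ ℕ→ℚ 5 ℚ.* (d ℚ.* f)) ℚ.+ ℕ→ℚ 5 ℚ.* (b ℚ.* (c ℚ.* f ℚ.+ d ℚ.* e))
  re-assoc = solve (a ∷ b ∷ c ∷ d ∷ e ∷ f ∷ []) ℚ-ring
  im-assoc : (a ℚ.* c ℚ.+ ℕ→ℚ 5 ℚ.* (b ℚ.* d)) ℚ.* f ℚ.+ (a ℚ.* d ℚ.+ b ℚ.* c) ℚ.* e
           ≡ a ℚ.* (c ℚ.* f ℚ.+ d ℚ.* e) ℚ.+ b ℚ.* (c ℚ.* e ℚ.+ ℕ→ℚ 5 ℚ.* (d ℚ.* f))
  im-assoc = solve (a ∷ b ∷ c ∷ d ∷ e ∷ f ∷ []) ℚ-ring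

⊗-comm : ∀ x y → x ⊗ y ≡ y ⊗ x
⊗-comm (a + b √5) (c + d √5) = cong₂ _+_√5 (solve (a ∷ b ∷ c ∷ d ∷ []) ℚ-ring) (solve (a ∷ b ∷ c ∷ d ∷ []) ℚ-ring)

⊗-identityˡ : ∀ x → one√5 ⊗ x ≡ x
⊗-identityˡ (a + b √5) = cong₂ _+_√5 (solve (a ∷ b ∷ []) ℚ-ring) (solve (a ∷ b ∷ []) ℚ-ring)

⊗-distribˡ-⊕ : ∀ x y z → x ⊗ (y ⊕ z) ≡ x ⊗ y ⊕ x ⊗ z
⊗-distribˡ-⊕ (a + b √5) (c + d √5) (e + f √5) = cong₂ _+_√5 re-distrib im-distrib
  where
  re-distrib : a ℚ.* (c ℚ.+ e) ℚ.+ ℕ→ℚ 5 ℚ.* (b ℚ.* (d ℚ.+ f))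
             ≡ (a ℚ.* c ℚ.+ ℕ→ℚ 5 ℚ.* (b ℚ.* d)) ℚ.+ (a ℚ.* e ℚ.+ ℕ→ℚ 5 ℚ.* (b ℚ.* f))
  re-distrib = solve (a ∷ b ∷ c ∷ d ∷ e ∷ f ∷ []) ℚ-ring
  im-distrib : a ℚ.* (d ℚ.+ f) ℚ.+ b ℚ.* (c ℚ.+ e) ≡ (a ℚ.* d ℚ.+ b ℚ.* c) ℚ.+ (a ℚ.* f ℚ.+ b ℚ.* e)
  im-distrib = solve (a ∷ b ∷ c ∷ d ∷ e ∷ f ∷ []) ℚ-ring

⊕-⊗-isCommutativeRing : IsCommutativeRing _⊕_ _⊗_ ⊖_ zero√5 one√5
⊕-⊗-isCommutativeRing = record
  { isRing = record
    { +-isAbelianGroup = record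
      { isGroup = record
        { isMonoid = record
          { isSemigroup = record
            { isMagma = record { isEquivalence = ≡.isEquivalence ; ∙-cong = cong₂ _⊕_ }
            ; assoc = ⊕-assoc }
          ; identity = ⊕-identityˡ , λ x → trans (⊕-comm x zero√5) (⊕-identityˡ x) }
        ; inverse = ⊖-inverseˡ , λ x → trans (⊕-comm x (⊖ x)) (⊖-inverseˡ x)
        ; ⁻¹-cong = cong ⊖_ }
      ; comm = ⊕-comm }
    ; *-cong = cong₂ _⊗_
    ; *-assoc = ⊗-assoc
    ; *-identity = ⊗-identityˡ , λ x → trans (⊗-comm x one√5) (⊗-identityˡ x)
    ; distrib = ⊗-distribˡ-⊕ , λ x y z → begin
        (y ⊕ z) ⊗ x      ≡⟨ ⊗-comm (y ⊕ z) x ⟩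
        x ⊗ (y ⊕ z)      ≡⟨ ⊗-distribˡ-⊕ x y z ⟩
        x ⊗ y ⊕ x ⊗ z    ≡⟨ cong₂ _⊕_ (⊗-comm x y) (⊗-comm x z) ⟩
        y ⊗ x ⊕ z ⊗ x    ∎ }
  ; *-comm = ⊗-comm }

⊕-⊗-commutativeRing : CommutativeRing 0ℓ 0ℓ
⊕-⊗-commutativeRing = record { isCommutativeRing = ⊕-⊗-isCommutativeRing }

open CommutativeRing ⊕-⊗-commutativeRing
  using () renaming (+-identityʳ to ⊕-identityʳ; zeroˡ to ⊗-zeroˡ; zeroʳ to ⊗-zeroʳ)

ℚ√5-ring : ACR.AlmostCommutativeRing 0ℓ 0ℓ
ℚ√5-ring = ACR.fromCommutativeRing ⊕-⊗-commutativeRing isZero?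
  where
  isZero? : ∀ x → Maybe (zero√5 ≡ x)
  isZero? (a + b √5) with 0ℚ ℚP.≟ a | 0ℚ ℚP.≟ b
  ... | yes a≡0 | yes b≡0 = just (cong₂ _+_√5 a≡0 b≡0)
  ... | _       | _       = nothing

embed : ℚ → ℚ√5
embed r = r + 0ℚ √5

embed-* : ∀ p q → embed (p ℚ.* q) ≡ embed p ⊗ embed q
embed-* p q = cong₂ _+_√5 re-part im-part
  where
  re-part : p ℚ.* q ≡ p ℚ.* q ℚ.+ ℕ→ℚ 5 ℚ.* (0ℚ ℚ.* 0ℚ)
  re-part = solve (p ∷ q ∷ []) ℚ-ring
  im-part : 0ℚ ≡ p ℚ.* 0ℚ ℚ.+ 0ℚ ℚ.* q
  im-part = solve (p ∷ q ∷ []) ℚ-ring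

•≡embed-⊗ : ∀ r x → r • x ≡ embed r ⊗ x
•≡embed-⊗ r (a + b √5) = cong₂ _+_√5 re-part im-part
  where
  re-part : r ℚ.* a ≡ r ℚ.* a ℚ.+ ℕ→ℚ 5 ℚ.* (0ℚ ℚ.* b)
  re-part = solve (r ∷ a ∷ b ∷ []) ℚ-ring
  im-part : r ℚ.* b ≡ r ℚ.* b ℚ.+ 0ℚ ℚ.* a
  im-part = solve (r ∷ a ∷ b ∷ []) ℚ-ring

^√5-distribˡ-+ : ∀ x m n → x ^√5 (m ℕ.+ n) ≡ x ^√5 m ⊗ x ^√5 n
^√5-distribˡ-+ x zero    n = sym (⊗-identityˡ (x ^√5 n))
^√5-distribˡ-+ x (suc m) n = trans (cong (x ⊗_) (^√5-distribˡ-+ x m n)) (sym (⊗-assoc x _ _))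

^√5-*-assoc : ∀ x m n → (x ^√5 m) ^√5 n ≡ x ^√5 (m ℕ.* n)
^√5-*-assoc x m zero    = cong (x ^√5_) (sym (ℕP.*-zeroʳ m))
^√5-*-assoc x m (suc n) = begin
  x ^√5 m ⊗ (x ^√5 m) ^√5 n   ≡⟨ cong (x ^√5 m ⊗_) (^√5-*-assoc x m n) ⟩
  x ^√5 m ⊗ x ^√5 (m ℕ.* n)   ≡⟨ ^√5-distribˡ-+ x m (m ℕ.* n) ⟨
  x ^√5 (m ℕ.+ m ℕ.* n)       ≡⟨ cong (x ^√5_) (ℕP.*-suc m n) ⟨
  x ^√5 (m ℕ.* suc n)         ∎

sum√5-cong : ∀ n {f g : ℕ → ℚ√5} → (∀ k → k ≤ n → f k ≡ g k) → sum√5 n f ≡ sum√5 n g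
sum√5-cong zero    f≗g = f≗g 0 z≤n
sum√5-cong (suc n) f≗g =
  cong₂ _⊕_ (sum√5-cong n (λ k k≤n → f≗g k (ℕP.m≤n⇒m≤1+n k≤n))) (f≗g (suc n) ℕP.≤-refl)

sum√5-⊕ : ∀ n (f g : ℕ → ℚ√5) → sum√5 n (λ k → f k ⊕ g k) ≡ sum√5 n f ⊕ sum√5 n g
sum√5-⊕ zero    f g = refl
sum√5-⊕ (suc n) f g = trans (cong (_⊕ (f (suc n) ⊕ g (suc n))) (sum√5-⊕ n f g))
                            (middle-four (sum√5 n f) (sum√5 n g) (f (suc n)) (g (suc n)))
  where
  middle-four : ∀ a b c d → (a ⊕ b) ⊕ (c ⊕ d) ≡ (a ⊕ c) ⊕ (b ⊕ d)
  middle-four a b c d = solve (a ∷ b ∷ c ∷ d ∷ []) ℚ√5-ring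

sum√5-⊖ : ∀ n (f : ℕ → ℚ√5) → sum√5 n (λ k → ⊖ f k) ≡ ⊖ sum√5 n f
sum√5-⊖ zero    f = refl
sum√5-⊖ (suc n) f = trans (cong (_⊕ ⊖ f (suc n)) (sum√5-⊖ n f)) (⊖-⊕ (sum√5 n f) (f (suc n)))
  where
  ⊖-⊕ : ∀ a b → ⊖ a ⊕ ⊖ b ≡ ⊖ (a ⊕ b)
  ⊖-⊕ a b = solve (a ∷ b ∷ []) ℚ√5-ring

⊗-distribˡ-sum√5 : ∀ n a (f : ℕ → ℚ√5) → a ⊗ sum√5 n f ≡ sum√5 n (λ k → a ⊗ f k)
⊗-distribˡ-sum√5 zero    a f = refl
⊗-distribˡ-sum√5 (suc n) a f =
  trans (⊗-distribˡ-⊕ a _ _) (cong (_⊕ a ⊗ f (suc n)) (⊗-distribˡ-sum√5 n a f))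

sum√5-zero : ∀ n {f : ℕ → ℚ√5} → (∀ k → k ≤ n → f k ≡ zero√5) → sum√5 n f ≡ zero√5
sum√5-zero zero    f≗0 = f≗0 0 z≤n
sum√5-zero (suc n) f≗0 =
  trans (cong₂ _⊕_ (sum√5-zero n (λ k k≤n → f≗0 k (ℕP.m≤n⇒m≤1+n k≤n))) (f≗0 (suc n) ℕP.≤-refl))
        (⊕-identityˡ zero√5)

sum√5-suc : ∀ n (f : ℕ → ℚ√5) → sum√5 (suc n) f ≡ f 0 ⊕ sum√5 n (λ k → f (suc k))
sum√5-suc zero    f = refl
sum√5-suc (suc n) f = trans (cong (_⊕ f (suc (suc n))) (sum√5-suc n f))
                            (⊕-assoc (f 0) (sum√5 n (λ k → f (suc k))) (f (suc (suc n))))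

sum√5-comm : ∀ n m (F : ℕ → ℕ → ℚ√5) →
             sum√5 n (λ k → sum√5 m (F k)) ≡ sum√5 m (λ i → sum√5 n (λ k → F k i))
sum√5-comm zero    m F = refl
sum√5-comm (suc n) m F = trans (cong (_⊕ sum√5 m (F (suc n))) (sum√5-comm n m F))
                               (sym (sum√5-⊕ m (λ i → sum√5 n (λ k → F k i)) (F (suc n))))

sum√5-single : ∀ n p {f : ℕ → ℚ√5} → p ≤ n → (∀ k → k ≤ n → k ≢ p → f k ≡ zero√5) →
               sum√5 n f ≡ f p
sum√5-single zero    .zero z≤n _   = refl
sum√5-single (suc n) p {f} p≤1+n off with p ℕP.≟ suc n
... | yes refl = trans (cong (_⊕ f (suc n)) (sum√5-zero n below)) (⊕-identityˡ (f (suc n)))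
  where
  below : ∀ k → k ≤ n → f k ≡ zero√5
  below k k≤n = off k (ℕP.m≤n⇒m≤1+n k≤n) (ℕP.<⇒≢ (s≤s k≤n))
... | no p≢1+n = trans (cong₂ _⊕_ (sum√5-single n p p≤n (λ k k≤n → off k (ℕP.m≤n⇒m≤1+n k≤n)))
                                 (off (suc n) ℕP.≤-refl (p≢1+n ∘ sym)))
                       (⊕-identityʳ (f p))
  where
  p≤n : p ≤ n
  p≤n = ℕP.≤-pred (ℕP.≤∧≢⇒< p≤1+n p≢1+n)

sum√5-shift : ∀ i N (f : ℕ → ℚ√5) → (∀ k → k < i → f k ≡ zero√5) →
              sum√5 (i ℕ.+ N) f ≡ sum√5 N (λ m → f (i ℕ.+ m))
sum√5-shift zero    N f _   = refl
sum√5-shift (suc i) N f f<i≗0 = begin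
  sum√5 (suc (i ℕ.+ N)) f                        ≡⟨ sum√5-suc (i ℕ.+ N) f ⟩
  f 0 ⊕ sum√5 (i ℕ.+ N) (λ k → f (suc k))        ≡⟨ cong₂ _⊕_ (f<i≗0 0 (s≤s z≤n))
                                                      (sum√5-shift i N (λ k → f (suc k)) (λ k k<i → f<i≗0 (suc k) (s≤s k<i))) ⟩
  zero√5 ⊕ sum√5 N (λ m → f (suc (i ℕ.+ m)))      ≡⟨ ⊕-identityˡ _ ⟩
  sum√5 N (λ m → f (suc i ℕ.+ m))                ∎

sum√5-reverse : ∀ n (f : ℕ → ℚ√5) → sum√5 n f ≡ sum√5 n (λ k → f (n ℕ.∸ k))
sum√5-reverse zero    f = refl
sum√5-reverse (suc n) f = begin
  sum√5 n f ⊕ f (suc n)                           ≡⟨ cong (_⊕ f (suc n)) (sum√5-reverse n f) ⟩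
  sum√5 n (λ k → f (n ℕ.∸ k)) ⊕ f (suc n)         ≡⟨ ⊕-comm _ (f (suc n)) ⟩
  f (suc n) ⊕ sum√5 n (λ k → f (n ℕ.∸ k))         ≡⟨ sum√5-suc n (λ k → f (suc n ℕ.∸ k)) ⟨
  sum√5 (suc n) (λ k → f (suc n ℕ.∸ k))           ∎

embed-sumℚ : ∀ n (f : ℕ → ℚ) → embed (sumℚ n f) ≡ sum√5 n (λ k → embed (f k))
embed-sumℚ zero    f = refl
embed-sumℚ (suc n) f = cong (_⊕ embed (f (suc n))) (embed-sumℚ n f)

-- Binomial coefficients

C*k!*[n∸k]!≡n! : ∀ {n k} → k ≤ n → (n C k) ℕ.* (k ! ℕ.* (n ℕ.∸ k) !) ≡ n !
C*k!*[n∸k]!≡n! {n} {k} k≤n = begin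
  (n C k) ℕ.* (k ! ℕ.* (n ℕ.∸ k) !)
    ≡⟨ cong (ℕ._* (k ! ℕ.* (n ℕ.∸ k) !)) (nCk≡n!/k![n-k]! k≤n) ⟩
  (n ! ℕ./ (k ! ℕ.* (n ℕ.∸ k) !)) {{k![n∸k]!≢0}} ℕ.* (k ! ℕ.* (n ℕ.∸ k) !)
    ≡⟨ m/n*n≡m {{k![n∸k]!≢0}} (k![n∸k]!∣n! k≤n) ⟩
  n !
    ∎
  where k![n∸k]!≢0 = k ℕP.!* (n ℕ.∸ k) !≢0

[a+b]Ca*a!*b!≡[a+b]! : ∀ a b → ((a ℕ.+ b) C a) ℕ.* (a ! ℕ.* b !) ≡ (a ℕ.+ b) !
[a+b]Ca*a!*b!≡[a+b]! a b =
  subst (λ z → ((a ℕ.+ b) C a) ℕ.* (a ! ℕ.* z !) ≡ (a ℕ.+ b) !) (ℕP.m+n∸m≡n a b)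
        (C*k!*[n∸k]!≡n! (ℕP.m≤m+n a b))

-- Multiplied by a! b! c!, both sides become (a + b + c)!.
C-trinomial-revision : ∀ a b c →
  ((a ℕ.+ b ℕ.+ c) C (a ℕ.+ b)) ℕ.* ((a ℕ.+ b) C a) ≡ ((a ℕ.+ b ℕ.+ c) C a) ℕ.* ((b ℕ.+ c) C b)
C-trinomial-revision a b c = ℕP.*-cancelʳ-≡ _ _ (a ! ℕ.* b ! ℕ.* c !) {{a!b!c!≢0}} (trans lhs≡N! (sym rhs≡N!))
  where
  N = a ℕ.+ b ℕ.+ c
  a!b!c!≢0 = ℕP.m*n≢0 (a ! ℕ.* b !) (c !) {{ℕP.m*n≢0 (a !) (b !) {{a ℕP.!≢0}} {{b ℕP.!≢0}}}} {{c ℕP.!≢0}}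
  regroupˡ : ∀ p q x y z → p ℕ.* q ℕ.* (x ℕ.* y ℕ.* z) ≡ p ℕ.* ((q ℕ.* (x ℕ.* y)) ℕ.* z)
  regroupˡ = ℕ-solve
  regroupʳ : ∀ p q x y z → p ℕ.* q ℕ.* (x ℕ.* y ℕ.* z) ≡ p ℕ.* (x ℕ.* (q ℕ.* (y ℕ.* z)))
  regroupʳ = ℕ-solve
  lhs≡N! : (N C (a ℕ.+ b)) ℕ.* ((a ℕ.+ b) C a) ℕ.* (a ! ℕ.* b ! ℕ.* c !) ≡ N !
  lhs≡N! = begin
    (N C (a ℕ.+ b)) ℕ.* ((a ℕ.+ b) C a) ℕ.* (a ! ℕ.* b ! ℕ.* c !)
      ≡⟨ regroupˡ (N C (a ℕ.+ b)) ((a ℕ.+ b) C a) (a !) (b !) (c !) ⟩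
    (N C (a ℕ.+ b)) ℕ.* ((((a ℕ.+ b) C a) ℕ.* (a ! ℕ.* b !)) ℕ.* c !)
      ≡⟨ cong (λ z → (N C (a ℕ.+ b)) ℕ.* (z ℕ.* c !)) ([a+b]Ca*a!*b!≡[a+b]! a b) ⟩
    (N C (a ℕ.+ b)) ℕ.* ((a ℕ.+ b) ! ℕ.* c !)
      ≡⟨ [a+b]Ca*a!*b!≡[a+b]! (a ℕ.+ b) c ⟩
    N ! ∎
  rhs≡N! : (N C a) ℕ.* ((b ℕ.+ c) C b) ℕ.* (a ! ℕ.* b ! ℕ.* c !) ≡ N !
  rhs≡N! = begin
    (N C a) ℕ.* ((b ℕ.+ c) C b) ℕ.* (a ! ℕ.* b ! ℕ.* c !)
      ≡⟨ regroupʳ (N C a) ((b ℕ.+ c) C b) (a !) (b !) (c !) ⟩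
    (N C a) ℕ.* (a ! ℕ.* (((b ℕ.+ c) C b) ℕ.* (b ! ℕ.* c !)))
      ≡⟨ cong (λ z → (N C a) ℕ.* (a ! ℕ.* z)) ([a+b]Ca*a!*b!≡[a+b]! b c) ⟩
    (N C a) ℕ.* (a ! ℕ.* (b ℕ.+ c) !)
      ≡⟨ cong (λ z → (z C a) ℕ.* (a ! ℕ.* (b ℕ.+ c) !)) (ℕP.+-assoc a b c) ⟩
    ((a ℕ.+ (b ℕ.+ c)) C a) ℕ.* (a ! ℕ.* (b ℕ.+ c) !)
      ≡⟨ [a+b]Ca*a!*b!≡[a+b]! a (b ℕ.+ c) ⟩
    (a ℕ.+ (b ℕ.+ c)) !
      ≡⟨ cong _! (ℕP.+-assoc a b c) ⟨
    N ! ∎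

infix 10 _C√5_

_C√5_ : ℕ → ℕ → ℚ√5
n C√5 k = embed (ℕ→ℚ (n C k))

k>n⇒nC√5k≡0 : ∀ {n k} → k > n → n C√5 k ≡ zero√5
k>n⇒nC√5k≡0 k>n = cong (embed ∘ ℕ→ℚ) (k>n⇒nCk≡0 k>n)

nC√50≡1 : ∀ n → n C√5 0 ≡ one√5
nC√50≡1 n = cong (embed ∘ ℕ→ℚ) (trans (nCk≡nC[n∸k] (z≤n {n})) (nCn≡1 n))

C√5-pascal : ∀ n k → suc n C√5 suc k ≡ n C√5 k ⊕ n C√5 suc k
C√5-pascal n k = trans (cong (embed ∘ ℕ→ℚ) (sym (nCk+nC[k+1]≡[n+1]C[k+1] n k)))
                       (cong embed (ℕ→ℚ-+ (n C k) (n C suc k)))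

C√5-* : ∀ a b c d → a C√5 b ⊗ c C√5 d ≡ embed (ℕ→ℚ ((a C b) ℕ.* (c C d)))
C√5-* a b c d = sym (trans (cong embed (ℕ→ℚ-* (a C b) (c C d))) (embed-* (ℕ→ℚ (a C b)) (ℕ→ℚ (c C d))))

C√5-trinomial-revision : ∀ i m N → m ≤ N →
  (i ℕ.+ N) C√5 (i ℕ.+ m) ⊗ (i ℕ.+ m) C√5 i ≡ (i ℕ.+ N) C√5 i ⊗ N C√5 m
C√5-trinomial-revision i m N m≤N = begin
  (i ℕ.+ N) C√5 (i ℕ.+ m) ⊗ (i ℕ.+ m) C√5 i            ≡⟨ cong (λ z → z C√5 (i ℕ.+ m) ⊗ (i ℕ.+ m) C√5 i) i+m+c≡i+N ⟨
  (i ℕ.+ m ℕ.+ c) C√5 (i ℕ.+ m) ⊗ (i ℕ.+ m) C√5 i      ≡⟨ C√5-* (i ℕ.+ m ℕ.+ c) (i ℕ.+ m) (i ℕ.+ m) i ⟩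
  embed (ℕ→ℚ (((i ℕ.+ m ℕ.+ c) C (i ℕ.+ m)) ℕ.* ((i ℕ.+ m) C i)))
                                                         ≡⟨ cong (embed ∘ ℕ→ℚ) (C-trinomial-revision i m c) ⟩
  embed (ℕ→ℚ (((i ℕ.+ m ℕ.+ c) C i) ℕ.* ((m ℕ.+ c) C m)))
                                                         ≡⟨ C√5-* (i ℕ.+ m ℕ.+ c) i (m ℕ.+ c) m ⟨
  (i ℕ.+ m ℕ.+ c) C√5 i ⊗ (m ℕ.+ c) C√5 m               ≡⟨ cong₂ (λ z w → z C√5 i ⊗ w C√5 m) i+m+c≡i+N m+c≡N ⟩
  (i ℕ.+ N) C√5 i ⊗ N C√5 m                             ∎
  where
  c = N ℕ.∸ m
  m+c≡N : m ℕ.+ c ≡ N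
  m+c≡N = ℕP.m+[n∸m]≡n m≤N
  i+m+c≡i+N : i ℕ.+ m ℕ.+ c ≡ i ℕ.+ N
  i+m+c≡i+N = trans (ℕP.+-assoc i m c) (cong (i ℕ.+_) m+c≡N)

binomialTerm : ℚ√5 → ℚ√5 → ℕ → ℕ → ℚ√5
binomialTerm β d k i = k C√5 i ⊗ (β ^√5 i ⊗ d ^√5 (k ℕ.∸ i))

binomialTerm-suc-zero : ∀ β d k → binomialTerm β d (suc k) 0 ≡ d ⊗ binomialTerm β d k 0
binomialTerm-suc-zero β d k = begin
  suc k C√5 0 ⊗ (one√5 ⊗ (d ⊗ d ^√5 k))   ≡⟨ cong (λ z → z ⊗ (one√5 ⊗ (d ⊗ d ^√5 k))) (nC√50≡1 (suc k)) ⟩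
  one√5 ⊗ (one√5 ⊗ (d ⊗ d ^√5 k))         ≡⟨ rearrange d (d ^√5 k) ⟩
  d ⊗ (one√5 ⊗ (one√5 ⊗ d ^√5 k))         ≡⟨ cong (λ z → d ⊗ (z ⊗ (one√5 ⊗ d ^√5 k))) (nC√50≡1 k) ⟨
  d ⊗ binomialTerm β d k 0                 ∎
  where
  rearrange : ∀ x y → one√5 ⊗ (one√5 ⊗ (x ⊗ y)) ≡ x ⊗ (one√5 ⊗ (one√5 ⊗ y))
  rearrange x y = solve (x ∷ y ∷ []) ℚ√5-ring

binomialTerm-suc-suc : ∀ β d k i →
  binomialTerm β d (suc k) (suc i) ≡ d ⊗ binomialTerm β d k (suc i) ⊕ β ⊗ binomialTerm β d k i
binomialTerm-suc-suc β d k i = begin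
  suc k C√5 suc i ⊗ (β ⊗ β ^√5 i ⊗ d ^√5 (k ℕ.∸ i))
    ≡⟨ cong (_⊗ (β ⊗ β ^√5 i ⊗ d ^√5 (k ℕ.∸ i))) (C√5-pascal k i) ⟩
  (k C√5 i ⊕ k C√5 suc i) ⊗ (β ⊗ β ^√5 i ⊗ d ^√5 (k ℕ.∸ i))
    ≡⟨ split (k C√5 i) (k C√5 suc i) β (β ^√5 i) (d ^√5 (k ℕ.∸ i)) ⟩
  k C√5 suc i ⊗ (β ⊗ β ^√5 i ⊗ d ^√5 (k ℕ.∸ i)) ⊕ β ⊗ binomialTerm β d k i
    ≡⟨ cong (_⊕ β ⊗ binomialTerm β d k i) upper ⟩
  d ⊗ binomialTerm β d k (suc i) ⊕ β ⊗ binomialTerm β d k i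
    ∎
  where
  split : ∀ c c′ b p q → (c ⊕ c′) ⊗ (b ⊗ p ⊗ q) ≡ c′ ⊗ (b ⊗ p ⊗ q) ⊕ b ⊗ (c ⊗ (p ⊗ q))
  split c c′ b p q = solve (c ∷ c′ ∷ b ∷ p ∷ q ∷ []) ℚ√5-ring
  upper : k C√5 suc i ⊗ (β ⊗ β ^√5 i ⊗ d ^√5 (k ℕ.∸ i)) ≡ d ⊗ binomialTerm β d k (suc i)
  upper = upper-cases (suc i ℕP.≤? k)
    where
    p = β ⊗ β ^√5 i ⊗ d ^√5 (k ℕ.∸ i)
    upper-cases : Dec (suc i ≤ k) → k C√5 suc i ⊗ p ≡ d ⊗ binomialTerm β d k (suc i)
    upper-cases (yes i<k) = begin
      k C√5 suc i ⊗ p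
        ≡⟨ cong (λ z → k C√5 suc i ⊗ (β ⊗ β ^√5 i ⊗ d ^√5 z)) (ℕP.+-∸-assoc 1 i<k) ⟩
      k C√5 suc i ⊗ (β ⊗ β ^√5 i ⊗ (d ⊗ d ^√5 (k ℕ.∸ suc i)))
        ≡⟨ rearrange (k C√5 suc i) (β ⊗ β ^√5 i) d (d ^√5 (k ℕ.∸ suc i)) ⟩
      d ⊗ binomialTerm β d k (suc i) ∎
      where
      rearrange : ∀ c x y q → c ⊗ (x ⊗ (y ⊗ q)) ≡ y ⊗ (c ⊗ (x ⊗ q))
      rearrange c x y q = solve (c ∷ x ∷ y ∷ q ∷ []) ℚ√5-ring
    upper-cases (no i≮k) = begin
      k C√5 suc i ⊗ p                 ≡⟨ cong (_⊗ p) C≡0 ⟩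
      zero√5 ⊗ p                      ≡⟨ annihilate d p q ⟩
      d ⊗ (zero√5 ⊗ q)                ≡⟨ cong (λ z → d ⊗ (z ⊗ q)) C≡0 ⟨
      d ⊗ binomialTerm β d k (suc i)  ∎
      where
      q = β ⊗ β ^√5 i ⊗ d ^√5 (k ℕ.∸ suc i)
      C≡0 = k>n⇒nC√5k≡0 (ℕP.≰⇒> i≮k)
      annihilate : ∀ x y z → zero√5 ⊗ y ≡ x ⊗ (zero√5 ⊗ z)
      annihilate x y z = solve (x ∷ y ∷ z ∷ []) ℚ√5-ring

binomial-theorem : ∀ β d k N → k ≤ N → (β ⊕ d) ^√5 k ≡ sum√5 N (binomialTerm β d k)
binomial-theorem β d zero N _ = sym (trans (sum√5-single N 0 z≤n (λ k _ → only-zero k)) base)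
  where
  base : binomialTerm β d 0 0 ≡ one√5
  -- Explicit endpoints: unifying against the closed term would evaluate rational arithmetic.
  base = trans (cong (_⊗ (one√5 ⊗ one√5)) {0 C√5 0} {one√5} (nC√50≡1 0))
               (trans (⊗-identityˡ (one√5 ⊗ one√5)) (⊗-identityˡ one√5))
  only-zero : ∀ k → k ≢ 0 → binomialTerm β d 0 k ≡ zero√5
  only-zero zero    k≢0 = ⊥-elim (k≢0 refl)
  only-zero (suc k) _   = trans (cong (_⊗ p) (k>n⇒nC√5k≡0 {0} {suc k} (s≤s z≤n))) (⊗-zeroˡ p)
    where p = β ^√5 suc k ⊗ one√5
binomial-theorem β d (suc k) (suc N) (s≤s k≤N) = sym (begin
  sum√5 (suc N) (t (suc k))
    ≡⟨ sum√5-suc N (t (suc k)) ⟩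
  t (suc k) 0 ⊕ sum√5 N (λ i → t (suc k) (suc i))
    ≡⟨ cong₂ _⊕_ (binomialTerm-suc-zero β d k)
                 (trans (sum√5-cong N (λ i _ → binomialTerm-suc-suc β d k i))
                        (sum√5-⊕ N (λ i → d ⊗ t k (suc i)) (λ i → β ⊗ t k i))) ⟩
  d ⊗ t k 0 ⊕ (sum√5 N (λ i → d ⊗ t k (suc i)) ⊕ sum√5 N (λ i → β ⊗ t k i))
    ≡⟨ cong (d ⊗ t k 0 ⊕_) (cong₂ _⊕_ (⊗-distribˡ-sum√5 N d (λ i → t k (suc i)))
                                      (⊗-distribˡ-sum√5 N β (t k))) ⟨
  d ⊗ t k 0 ⊕ (d ⊗ sum√5 N (λ i → t k (suc i)) ⊕ β ⊗ sum√5 N (t k))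
    ≡⟨ regroup d β (t k 0) (sum√5 N (λ i → t k (suc i))) (sum√5 N (t k)) ⟩
  d ⊗ (t k 0 ⊕ sum√5 N (λ i → t k (suc i))) ⊕ β ⊗ sum√5 N (t k)
    ≡⟨ cong₂ (λ a b → d ⊗ a ⊕ β ⊗ b)
             (trans (binomial-theorem β d k (suc N) (ℕP.m≤n⇒m≤1+n k≤N)) (sum√5-suc N (t k)))
             (binomial-theorem β d k N k≤N) ⟨
  d ⊗ (β ⊕ d) ^√5 k ⊕ β ⊗ (β ⊕ d) ^√5 k
    ≡⟨ factor d β ((β ⊕ d) ^√5 k) ⟩
  (β ⊕ d) ⊗ (β ⊕ d) ^√5 k
    ∎)
  where
  t = binomialTerm β d
  regroup : ∀ x y p q r → x ⊗ p ⊕ (x ⊗ q ⊕ y ⊗ r) ≡ x ⊗ (p ⊕ q) ⊕ y ⊗ r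
  regroup x y p q r = solve (x ∷ y ∷ p ∷ q ∷ r ∷ []) ℚ√5-ring
  factor : ∀ x y p → x ⊗ p ⊕ y ⊗ p ≡ (y ⊕ x) ⊗ p
  factor x y p = solve (x ∷ y ∷ p ∷ []) ℚ√5-ring

-- Bernoulli numbers

bernTable-suc : ∀ m k → k ≤ m → bernTable (suc m) k ≡ bernTable m k
bernTable-suc m k k≤m with k ℕ.≤ᵇ m in k≤ᵇm
... | true  = refl
... | false = ⊥-elim (subst T k≤ᵇm (ℕP.≤⇒≤ᵇ k≤m))

bernTable≡bernoulli : ∀ m k → k ≤ m → bernTable m k ≡ bernoulli k
bernTable≡bernoulli zero    .zero z≤n = refl
bernTable≡bernoulli (suc m) k k≤1+m with k ℕP.≤? m
... | yes k≤m = trans (bernTable-suc m k k≤m) (bernTable≡bernoulli m k k≤m)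
... | no  k≰m with ℕP.≤-antisym k≤1+m (ℕP.≰⇒> k≰m)
...   | refl = refl

bernoulli-suc : ∀ m → bernoulli (suc m) ≡
  ℚ.- (sumℚ m (λ i → ℕ→ℚ (suc (suc m) C i) ℚ.* bernTable m i) ℚ.* (+ 1 ℚ./ suc (suc m)))
bernoulli-suc m with suc m ℕ.≤ᵇ m in 1+m≤ᵇm
... | true  = ⊥-elim (ℕP.<-irrefl refl (ℕP.≤ᵇ⇒≤ (suc m) m (subst T (sym 1+m≤ᵇm) _)))
... | false = refl

[1+n]Cn≡1+n : ∀ n → suc n C n ≡ suc n
[1+n]Cn≡1+n n = begin
  suc n C n              ≡⟨ nCk≡nC[n∸k] (ℕP.n≤1+n n) ⟩
  suc n C (suc n ℕ.∸ n)  ≡⟨ cong (suc n C_) (ℕP.m+n∸n≡m 1 n) ⟩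
  suc n C 1              ≡⟨ nC1≡n (suc n) ⟩
  suc n                  ∎

nC√5n≡1 : ∀ n → n C√5 n ≡ one√5
nC√5n≡1 n = cong (embed ∘ ℕ→ℚ) (nCn≡1 n)

B√5 : ℕ → ℚ√5
B√5 n = embed (bernoulli n)

δ₁ : ℕ → ℚ√5
δ₁ 1 = one√5
δ₁ _ = zero√5

δ₁-off : ∀ {j} → j ≢ 1 → δ₁ j ≡ zero√5
δ₁-off {zero}          _   = refl
δ₁-off {suc zero}      j≢1 = ⊥-elim (j≢1 refl)
δ₁-off {suc (suc _)}   _   = refl

bernoulli-recurrence : ∀ N → sum√5 N (λ l → N C√5 l ⊗ B√5 l) ≡ B√5 N ⊕ δ₁ N
bernoulli-recurrence zero = begin
  0 C√5 0 ⊗ B√5 0     ≡⟨ cong (_⊗ B√5 0) {0 C√5 0} {one√5} (nC√50≡1 0) ⟩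
  one√5 ⊗ B√5 0       ≡⟨ ⊗-identityˡ (B√5 0) ⟩
  B√5 0               ≡⟨ ⊕-identityʳ (B√5 0) ⟨
  B√5 0 ⊕ zero√5      ∎
bernoulli-recurrence (suc zero) = begin
  1 C√5 0 ⊗ B√5 0 ⊕ 1 C√5 1 ⊗ B√5 1
    ≡⟨ cong₂ (λ c c′ → c ⊗ B√5 0 ⊕ c′ ⊗ B√5 1) {1 C√5 0} {one√5} {1 C√5 1} {one√5} (nC√50≡1 1) (nC√5n≡1 1) ⟩
  one√5 ⊗ B√5 0 ⊕ one√5 ⊗ B√5 1
    ≡⟨ cong₂ _⊕_ (⊗-identityˡ (B√5 0)) (⊗-identityˡ (B√5 1)) ⟩
  B√5 0 ⊕ B√5 1
    ≡⟨ ⊕-comm (B√5 0) (B√5 1) ⟩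
  B√5 1 ⊕ B√5 0
    ∎
bernoulli-recurrence (suc (suc m)) = begin
  sum√5 m f ⊕ f (suc m) ⊕ f N
    ≡⟨ cong (_⊕ f N) (cong₂ _⊕_ lower-terms top-term) ⟩
  embed S ⊕ embed (ℕ→ℚ N ℚ.* ℚ.- (S ℚ.* (+ 1 ℚ./ N))) ⊕ f N
    ≡⟨ cong (λ z → embed z ⊕ f N) (cancel S (ℕ→ℚ N) (+ 1 ℚ./ N) (a/n*n≡a 1 (suc m))) ⟩
  zero√5 ⊕ f N
    ≡⟨ ⊕-identityˡ (f N) ⟩
  N C√5 N ⊗ B√5 N
    ≡⟨ cong (_⊗ B√5 N) (nC√5n≡1 N) ⟩
  one√5 ⊗ B√5 N
    ≡⟨ ⊗-identityˡ (B√5 N) ⟩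
  B√5 N
    ≡⟨ ⊕-identityʳ (B√5 N) ⟨
  B√5 N ⊕ zero√5
    ∎
  where
  N = suc (suc m)
  f = λ l → N C√5 l ⊗ B√5 l
  S = sumℚ m (λ i → ℕ→ℚ (N C i) ℚ.* bernTable m i)
  lower-terms : sum√5 m f ≡ embed S
  lower-terms = sym (begin
    embed S
      ≡⟨ embed-sumℚ m (λ i → ℕ→ℚ (N C i) ℚ.* bernTable m i) ⟩
    sum√5 m (λ i → embed (ℕ→ℚ (N C i) ℚ.* bernTable m i))
      ≡⟨ sum√5-cong m (λ i i≤m → cong (λ b → embed (ℕ→ℚ (N C i) ℚ.* b)) (bernTable≡bernoulli m i i≤m)) ⟩
    sum√5 m (λ i → embed (ℕ→ℚ (N C i) ℚ.* bernoulli i))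
      ≡⟨ sum√5-cong m (λ i _ → embed-* (ℕ→ℚ (N C i)) (bernoulli i)) ⟩
    sum√5 m f
      ∎)
  top-term : f (suc m) ≡ embed (ℕ→ℚ N ℚ.* ℚ.- (S ℚ.* (+ 1 ℚ./ N)))
  top-term = begin
    N C√5 suc m ⊗ B√5 (suc m)
      ≡⟨ cong₂ (λ c b → embed (ℕ→ℚ c) ⊗ embed b) ([1+n]Cn≡1+n (suc m)) (bernoulli-suc m) ⟩
    embed (ℕ→ℚ N) ⊗ embed (ℚ.- (S ℚ.* (+ 1 ℚ./ N)))
      ≡⟨ embed-* (ℕ→ℚ N) (ℚ.- (S ℚ.* (+ 1 ℚ./ N))) ⟨
    embed (ℕ→ℚ N ℚ.* ℚ.- (S ℚ.* (+ 1 ℚ./ N)))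
      ∎
  cancel : ∀ s n i → i ℚ.* n ≡ 1ℚ → s ℚ.+ n ℚ.* ℚ.- (s ℚ.* i) ≡ 0ℚ
  cancel s n i i*n≡1 = begin
    s ℚ.+ n ℚ.* ℚ.- (s ℚ.* i)   ≡⟨ solve (s ∷ n ∷ i ∷ []) ℚ-ring ⟩
    s ℚ.- s ℚ.* (i ℚ.* n)       ≡⟨ cong (λ z → s ℚ.- s ℚ.* z) i*n≡1 ⟩
    s ℚ.- s ℚ.* 1ℚ              ≡⟨ solve (s ∷ []) ℚ-ring ⟩
    0ℚ                          ∎

-- Bernoulli polynomials

bernoulliPolyCoeff : ℕ → ℕ → ℚ√5
bernoulliPolyCoeff n k = n C√5 k ⊗ B√5 (n ℕ.∸ k)

sum-bernoulliPolyCoeff-C : ∀ i N →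
  sum√5 (i ℕ.+ N) (λ k → bernoulliPolyCoeff (i ℕ.+ N) k ⊗ k C√5 i) ≡ (i ℕ.+ N) C√5 i ⊗ (B√5 N ⊕ δ₁ N)
sum-bernoulliPolyCoeff-C i N = begin
  sum√5 n (λ k → a k ⊗ k C√5 i)
    ≡⟨ sum√5-shift i N (λ k → a k ⊗ k C√5 i) (λ k k<i → trans (cong (a k ⊗_) (k>n⇒nC√5k≡0 k<i)) (⊗-zeroʳ (a k))) ⟩
  sum√5 N (λ m → a (i ℕ.+ m) ⊗ (i ℕ.+ m) C√5 i)
    ≡⟨ sum√5-cong N (λ m m≤N → revise m m≤N) ⟩
  sum√5 N (λ m → n C√5 i ⊗ (N C√5 m ⊗ B√5 (N ℕ.∸ m)))
    ≡⟨ ⊗-distribˡ-sum√5 N (n C√5 i) (λ m → N C√5 m ⊗ B√5 (N ℕ.∸ m)) ⟨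
  n C√5 i ⊗ sum√5 N (λ m → N C√5 m ⊗ B√5 (N ℕ.∸ m))
    ≡⟨ cong (n C√5 i ⊗_) (trans (sum√5-reverse N (λ m → N C√5 m ⊗ B√5 (N ℕ.∸ m))) (sum√5-cong N reflect)) ⟩
  n C√5 i ⊗ sum√5 N (λ l → N C√5 l ⊗ B√5 l)
    ≡⟨ cong (n C√5 i ⊗_) (bernoulli-recurrence N) ⟩
  n C√5 i ⊗ (B√5 N ⊕ δ₁ N)
    ∎
  where
  n = i ℕ.+ N
  a = bernoulliPolyCoeff n
  revise : ∀ m → m ≤ N → a (i ℕ.+ m) ⊗ (i ℕ.+ m) C√5 i ≡ n C√5 i ⊗ (N C√5 m ⊗ B√5 (N ℕ.∸ m))
  revise m m≤N = begin
    n C√5 (i ℕ.+ m) ⊗ B√5 (n ℕ.∸ (i ℕ.+ m)) ⊗ (i ℕ.+ m) C√5 i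
      ≡⟨ swap (n C√5 (i ℕ.+ m)) (B√5 (n ℕ.∸ (i ℕ.+ m))) ((i ℕ.+ m) C√5 i) ⟩
    n C√5 (i ℕ.+ m) ⊗ (i ℕ.+ m) C√5 i ⊗ B√5 (n ℕ.∸ (i ℕ.+ m))
      ≡⟨ cong₂ _⊗_ (C√5-trinomial-revision i m N m≤N) (cong B√5 (ℕP.[m+n]∸[m+o]≡n∸o i N m)) ⟩
    n C√5 i ⊗ N C√5 m ⊗ B√5 (N ℕ.∸ m)
      ≡⟨ ⊗-assoc (n C√5 i) (N C√5 m) (B√5 (N ℕ.∸ m)) ⟩
    n C√5 i ⊗ (N C√5 m ⊗ B√5 (N ℕ.∸ m))
      ∎
    where
    swap : ∀ x y z → x ⊗ y ⊗ z ≡ x ⊗ z ⊗ y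
    swap x y z = solve (x ∷ y ∷ z ∷ []) ℚ√5-ring
  reflect : ∀ l → l ≤ N → N C√5 (N ℕ.∸ l) ⊗ B√5 (N ℕ.∸ (N ℕ.∸ l)) ≡ N C√5 l ⊗ B√5 l
  reflect l l≤N = cong₂ (λ c m → embed (ℕ→ℚ c) ⊗ B√5 m) (sym (nCk≡nC[n∸k] l≤N)) (ℕP.m∸[m∸n]≡n l≤N)

bernoulliPoly-shift-coeff : ∀ n i → i ≤ n →
  sum√5 n (λ k → bernoulliPolyCoeff n k ⊗ k C√5 i) ⊕ ⊖ bernoulliPolyCoeff n i ≡ n C√5 i ⊗ δ₁ (n ℕ.∸ i)
bernoulliPoly-shift-coeff n i i≤n =
  subst (λ n → sum√5 n (λ k → bernoulliPolyCoeff n k ⊗ k C√5 i) ⊕ ⊖ bernoulliPolyCoeff n i ≡ n C√5 i ⊗ δ₁ (n ℕ.∸ i))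
        (ℕP.m+[n∸m]≡n i≤n) (shifted (n ℕ.∸ i))
  where
  shifted : ∀ N → sum√5 (i ℕ.+ N) (λ k → bernoulliPolyCoeff (i ℕ.+ N) k ⊗ k C√5 i) ⊕ ⊖ bernoulliPolyCoeff (i ℕ.+ N) i
                    ≡ (i ℕ.+ N) C√5 i ⊗ δ₁ (i ℕ.+ N ℕ.∸ i)
  shifted N = begin
    sum√5 (i ℕ.+ N) (λ k → bernoulliPolyCoeff (i ℕ.+ N) k ⊗ k C√5 i) ⊕ ⊖ bernoulliPolyCoeff (i ℕ.+ N) i
      ≡⟨ cong₂ (λ s b → s ⊕ ⊖ ((i ℕ.+ N) C√5 i ⊗ B√5 b)) (sum-bernoulliPolyCoeff-C i N) (ℕP.m+n∸m≡n i N) ⟩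
    (i ℕ.+ N) C√5 i ⊗ (B√5 N ⊕ δ₁ N) ⊕ ⊖ ((i ℕ.+ N) C√5 i ⊗ B√5 N)
      ≡⟨ cancel ((i ℕ.+ N) C√5 i) (B√5 N) (δ₁ N) ⟩
    (i ℕ.+ N) C√5 i ⊗ δ₁ N
      ≡⟨ cong (λ m → (i ℕ.+ N) C√5 i ⊗ δ₁ m) (ℕP.m+n∸m≡n i N) ⟨
    (i ℕ.+ N) C√5 i ⊗ δ₁ (i ℕ.+ N ℕ.∸ i)
      ∎
    where
    cancel : ∀ c b e → c ⊗ (b ⊕ e) ⊕ ⊖ (c ⊗ b) ≡ c ⊗ e
    cancel c b e = solve (c ∷ b ∷ e ∷ []) ℚ√5-ring

[n∸k]+[k∸i]≡n∸i : ∀ n k i → i ≤ k → k ≤ n → (n ℕ.∸ k) ℕ.+ (k ℕ.∸ i) ≡ n ℕ.∸ i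
[n∸k]+[k∸i]≡n∸i n       k       zero    _         k≤n       = ℕP.m∸n+n≡m k≤n
[n∸k]+[k∸i]≡n∸i (suc n) (suc k) (suc i) (s≤s i≤k) (s≤s k≤n) = [n∸k]+[k∸i]≡n∸i n k i i≤k k≤n

module _ (β d : ℚ√5) where

  monomial : ℕ → ℕ → ℚ√5
  monomial n i = β ^√5 i ⊗ d ^√5 (n ℕ.∸ i)

  expand-term : ∀ n k i → k ≤ n →
    (bernoulliPolyCoeff n k ⊗ d ^√5 (n ℕ.∸ k)) ⊗ binomialTerm β d k i ≡ monomial n i ⊗ (bernoulliPolyCoeff n k ⊗ k C√5 i)
  expand-term n k i k≤n = cases (i ℕP.≤? k)
    where
    a = bernoulliPolyCoeff n k
    cases : Dec (i ≤ k) → (a ⊗ d ^√5 (n ℕ.∸ k)) ⊗ binomialTerm β d k i ≡ monomial n i ⊗ (a ⊗ k C√5 i)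
    cases (yes i≤k) = begin
      (a ⊗ d ^√5 (n ℕ.∸ k)) ⊗ (k C√5 i ⊗ (β ^√5 i ⊗ d ^√5 (k ℕ.∸ i)))
        ≡⟨ rearrange a (d ^√5 (n ℕ.∸ k)) (k C√5 i) (β ^√5 i) (d ^√5 (k ℕ.∸ i)) ⟩
      (β ^√5 i ⊗ (d ^√5 (n ℕ.∸ k) ⊗ d ^√5 (k ℕ.∸ i))) ⊗ (a ⊗ k C√5 i)
        ≡⟨ cong (λ z → (β ^√5 i ⊗ z) ⊗ (a ⊗ k C√5 i)) (^√5-distribˡ-+ d (n ℕ.∸ k) (k ℕ.∸ i)) ⟨
      (β ^√5 i ⊗ d ^√5 ((n ℕ.∸ k) ℕ.+ (k ℕ.∸ i))) ⊗ (a ⊗ k C√5 i)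
        ≡⟨ cong (λ m → (β ^√5 i ⊗ d ^√5 m) ⊗ (a ⊗ k C√5 i)) ([n∸k]+[k∸i]≡n∸i n k i i≤k k≤n) ⟩
      monomial n i ⊗ (a ⊗ k C√5 i)
        ∎
      where
      rearrange : ∀ a x c b y → (a ⊗ x) ⊗ (c ⊗ (b ⊗ y)) ≡ (b ⊗ (x ⊗ y)) ⊗ (a ⊗ c)
      rearrange a x c b y = solve (a ∷ x ∷ c ∷ b ∷ y ∷ []) ℚ√5-ring
    cases (no i≰k) = begin
      (a ⊗ d ^√5 (n ℕ.∸ k)) ⊗ (k C√5 i ⊗ p)     ≡⟨ cong (λ c → (a ⊗ d ^√5 (n ℕ.∸ k)) ⊗ (c ⊗ p)) C≡0 ⟩
      (a ⊗ d ^√5 (n ℕ.∸ k)) ⊗ (zero√5 ⊗ p)      ≡⟨ annihilate (a ⊗ d ^√5 (n ℕ.∸ k)) p (monomial n i) a ⟩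
      monomial n i ⊗ (a ⊗ zero√5)               ≡⟨ cong (λ c → monomial n i ⊗ (a ⊗ c)) C≡0 ⟨
      monomial n i ⊗ (a ⊗ k C√5 i)              ∎
      where
      p = β ^√5 i ⊗ d ^√5 (k ℕ.∸ i)
      C≡0 = k>n⇒nC√5k≡0 (ℕP.≰⇒> i≰k)
      annihilate : ∀ x y z w → x ⊗ (zero√5 ⊗ y) ≡ z ⊗ (w ⊗ zero√5)
      annihilate x y z w = solve (x ∷ y ∷ z ∷ w ∷ []) ℚ√5-ring

  bernoulliPoly-difference : ∀ n →
    sum√5 n (λ k → bernoulliPolyCoeff n k ⊗ (d ^√5 (n ℕ.∸ k) ⊗ ((β ⊕ d) ^√5 k ⊕ ⊖ β ^√5 k)))
      ≡ sum√5 n (λ i → monomial n i ⊗ (n C√5 i ⊗ δ₁ (n ℕ.∸ i)))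
  bernoulliPoly-difference n = begin
    sum√5 n (λ k → a k ⊗ (D k ⊗ ((β ⊕ d) ^√5 k ⊕ ⊖ β ^√5 k)))
      ≡⟨ sum√5-cong n (λ k _ → split (a k) (D k) ((β ⊕ d) ^√5 k) (β ^√5 k)) ⟩
    sum√5 n (λ k → (a k ⊗ D k) ⊗ (β ⊕ d) ^√5 k ⊕ ⊖ ((a k ⊗ D k) ⊗ β ^√5 k))
      ≡⟨ sum√5-⊕ n (λ k → (a k ⊗ D k) ⊗ (β ⊕ d) ^√5 k) (λ k → ⊖ ((a k ⊗ D k) ⊗ β ^√5 k)) ⟩
    sum√5 n (λ k → (a k ⊗ D k) ⊗ (β ⊕ d) ^√5 k) ⊕ sum√5 n (λ k → ⊖ ((a k ⊗ D k) ⊗ β ^√5 k))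
      ≡⟨ cong₂ _⊕_ shifted (trans (sum√5-⊖ n (λ k → (a k ⊗ D k) ⊗ β ^√5 k)) (cong ⊖_ unshifted)) ⟩
    sum√5 n (λ i → monomial n i ⊗ G i) ⊕ ⊖ sum√5 n (λ i → monomial n i ⊗ a i)
      ≡⟨ cong (sum√5 n (λ i → monomial n i ⊗ G i) ⊕_) (sum√5-⊖ n (λ i → monomial n i ⊗ a i)) ⟨
    sum√5 n (λ i → monomial n i ⊗ G i) ⊕ sum√5 n (λ i → ⊖ (monomial n i ⊗ a i))
      ≡⟨ sum√5-⊕ n (λ i → monomial n i ⊗ G i) (λ i → ⊖ (monomial n i ⊗ a i)) ⟨
    sum√5 n (λ i → monomial n i ⊗ G i ⊕ ⊖ (monomial n i ⊗ a i))
      ≡⟨ sum√5-cong n (λ i i≤n → trans (factor (monomial n i) (G i) (a i))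
                                        (cong (monomial n i ⊗_) (bernoulliPoly-shift-coeff n i i≤n))) ⟩
    sum√5 n (λ i → monomial n i ⊗ (n C√5 i ⊗ δ₁ (n ℕ.∸ i)))
      ∎
    where
    a = bernoulliPolyCoeff n
    D = λ k → d ^√5 (n ℕ.∸ k)
    G = λ i → sum√5 n (λ k → a k ⊗ k C√5 i)
    split : ∀ a x p q → a ⊗ (x ⊗ (p ⊕ ⊖ q)) ≡ (a ⊗ x) ⊗ p ⊕ ⊖ ((a ⊗ x) ⊗ q)
    split a x p q = solve (a ∷ x ∷ p ∷ q ∷ []) ℚ√5-ring
    factor : ∀ p g a → p ⊗ g ⊕ ⊖ (p ⊗ a) ≡ p ⊗ (g ⊕ ⊖ a)
    factor p g a = solve (p ∷ g ∷ a ∷ []) ℚ√5-ring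
    commute : ∀ a x b → (a ⊗ x) ⊗ b ≡ (b ⊗ x) ⊗ a
    commute a x b = solve (a ∷ x ∷ b ∷ []) ℚ√5-ring
    unshifted : sum√5 n (λ k → (a k ⊗ D k) ⊗ β ^√5 k) ≡ sum√5 n (λ i → monomial n i ⊗ a i)
    unshifted = sum√5-cong n (λ k _ → commute (a k) (D k) (β ^√5 k))
    shifted : sum√5 n (λ k → (a k ⊗ D k) ⊗ (β ⊕ d) ^√5 k) ≡ sum√5 n (λ i → monomial n i ⊗ G i)
    shifted = begin
      sum√5 n (λ k → (a k ⊗ D k) ⊗ (β ⊕ d) ^√5 k)
        ≡⟨ sum√5-cong n (λ k k≤n → trans (cong ((a k ⊗ D k) ⊗_) (binomial-theorem β d k n k≤n))
                                         (⊗-distribˡ-sum√5 n (a k ⊗ D k) (binomialTerm β d k))) ⟩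
      sum√5 n (λ k → sum√5 n (λ i → (a k ⊗ D k) ⊗ binomialTerm β d k i))
        ≡⟨ sum√5-comm n n (λ k i → (a k ⊗ D k) ⊗ binomialTerm β d k i) ⟩
      sum√5 n (λ i → sum√5 n (λ k → (a k ⊗ D k) ⊗ binomialTerm β d k i))
        ≡⟨ sum√5-cong n (λ i _ → trans (sum√5-cong n (λ k k≤n → expand-term n k i k≤n))
                                       (sym (⊗-distribˡ-sum√5 n (monomial n i) (λ k → a k ⊗ k C√5 i)))) ⟩
      sum√5 n (λ i → monomial n i ⊗ G i)
        ∎

  -- d^n (B_n(x + 1) − B_n(x)) = n d^n x^(n−1) at x = β/d, with n = m + 1.
  bernoulli-difference : ∀ m →
    sum√5 (suc m) (λ k → bernoulliPolyCoeff (suc m) k ⊗ (d ^√5 (suc m ℕ.∸ k) ⊗ ((β ⊕ d) ^√5 k ⊕ ⊖ β ^√5 k)))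
      ≡ embed (ℕ→ℚ (suc m)) ⊗ (d ⊗ β ^√5 m)
  bernoulli-difference m = begin
    sum√5 (suc m) (λ k → bernoulliPolyCoeff (suc m) k ⊗ (d ^√5 (suc m ℕ.∸ k) ⊗ ((β ⊕ d) ^√5 k ⊕ ⊖ β ^√5 k)))
      ≡⟨ bernoulliPoly-difference (suc m) ⟩
    sum√5 (suc m) (λ i → monomial (suc m) i ⊗ (suc m C√5 i ⊗ δ₁ (suc m ℕ.∸ i)))
      ≡⟨ sum√5-single (suc m) m (ℕP.n≤1+n m) off-diagonal ⟩
    monomial (suc m) m ⊗ (suc m C√5 m ⊗ δ₁ (suc m ℕ.∸ m))
      ≡⟨ cong (λ j → (β ^√5 m ⊗ d ^√5 j) ⊗ (suc m C√5 m ⊗ δ₁ j)) (ℕP.m+n∸n≡m 1 m) ⟩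
    (β ^√5 m ⊗ (d ⊗ one√5)) ⊗ (suc m C√5 m ⊗ one√5)
      ≡⟨ cong (λ c → (β ^√5 m ⊗ (d ⊗ one√5)) ⊗ (embed (ℕ→ℚ c) ⊗ one√5)) ([1+n]Cn≡1+n m) ⟩
    (β ^√5 m ⊗ (d ⊗ one√5)) ⊗ (embed (ℕ→ℚ (suc m)) ⊗ one√5)
      ≡⟨ rearrange (β ^√5 m) d (embed (ℕ→ℚ (suc m))) ⟩
    embed (ℕ→ℚ (suc m)) ⊗ (d ⊗ β ^√5 m)
      ∎
    where
    rearrange : ∀ b x e → (b ⊗ (x ⊗ one√5)) ⊗ (e ⊗ one√5) ≡ e ⊗ (x ⊗ b)
    rearrange b x e = solve (b ∷ x ∷ e ∷ []) ℚ√5-ring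
    ⊗-zero₂ : ∀ x y → x ⊗ (y ⊗ zero√5) ≡ zero√5
    ⊗-zero₂ x y = solve (x ∷ y ∷ []) ℚ√5-ring
    off-diagonal : ∀ i → i ≤ suc m → i ≢ m → monomial (suc m) i ⊗ (suc m C√5 i ⊗ δ₁ (suc m ℕ.∸ i)) ≡ zero√5
    off-diagonal i i≤1+m i≢m = begin
      monomial (suc m) i ⊗ (suc m C√5 i ⊗ δ₁ (suc m ℕ.∸ i))   ≡⟨ cong (λ e → monomial (suc m) i ⊗ (suc m C√5 i ⊗ e)) (δ₁-off 1+m∸i≢1) ⟩
      monomial (suc m) i ⊗ (suc m C√5 i ⊗ zero√5)             ≡⟨ ⊗-zero₂ (monomial (suc m) i) (suc m C√5 i) ⟩
      zero√5                                                  ∎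
      where
      1+m∸i≢1 : suc m ℕ.∸ i ≢ 1
      1+m∸i≢1 1+m∸i≡1 = i≢m (ℕP.+-cancelʳ-≡ 1 i m (begin
        i ℕ.+ 1                 ≡⟨ cong (i ℕ.+_) 1+m∸i≡1 ⟨
        i ℕ.+ (suc m ℕ.∸ i)     ≡⟨ ℕP.m+[n∸m]≡n i≤1+m ⟩
        suc m                   ≡⟨ ℕP.+-comm 1 m ⟩
        m ℕ.+ 1                 ∎))

-- Binet's formulas

fib-lucas-suc : ∀ m → 2 ℕ.* fib (suc m) ≡ lucas m ℕ.+ fib m × 2 ℕ.* lucas (suc m) ≡ lucas m ℕ.+ 5 ℕ.* fib m
fib-lucas-suc zero          = refl , refl
fib-lucas-suc (suc zero)    = refl , refl
fib-lucas-suc (suc (suc m)) with fib-lucas-suc (suc m) | fib-lucas-suc m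
... | F₁ , L₁ | F₀ , L₀ =
  trans (ℕP.*-distribˡ-+ 2 (fib (suc (suc m))) (fib (suc m)))
        (trans (cong₂ ℕ._+_ F₁ F₀) (interchange (lucas (suc m)) (fib (suc m)) (lucas m) (fib m))) ,
  trans (ℕP.*-distribˡ-+ 2 (lucas (suc (suc m))) (lucas (suc m)))
        (trans (cong₂ ℕ._+_ L₁ L₀) (interchange₅ (lucas (suc m)) (fib (suc m)) (lucas m) (fib m)))
  where
  interchange : ∀ a b c d → (a ℕ.+ b) ℕ.+ (c ℕ.+ d) ≡ (a ℕ.+ c) ℕ.+ (b ℕ.+ d)
  interchange = ℕ-solve
  interchange₅ : ∀ a b c d → (a ℕ.+ 5 ℕ.* b) ℕ.+ (c ℕ.+ 5 ℕ.* d) ≡ (a ℕ.+ c) ℕ.+ 5 ℕ.* (b ℕ.+ d)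
  interchange₅ = ℕ-solve

½*2≡1 : ½ ℚ.* ℕ→ℚ 2 ≡ 1ℚ
½*2≡1 = a/n*n≡a 1 1

ℕ→ℚ[2*n]*½≡ℕ→ℚn : ∀ n → ℕ→ℚ (2 ℕ.* n) ℚ.* ½ ≡ ℕ→ℚ n
ℕ→ℚ[2*n]*½≡ℕ→ℚn n = trans (cong (ℚ._* ½) (ℕ→ℚ-* 2 n)) (halve (ℕ→ℚ n))
  where
  halve : ∀ x → ℕ→ℚ 2 ℚ.* x ℚ.* ½ ≡ x
  halve x = begin
    ℕ→ℚ 2 ℚ.* x ℚ.* ½     ≡⟨ solve (x ∷ []) ℚ-ring ⟩
    x ℚ.* (½ ℚ.* ℕ→ℚ 2)   ≡⟨ cong (x ℚ.*_) ½*2≡1 ⟩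
    x ℚ.* 1ℚ               ≡⟨ ℚP.*-identityʳ x ⟩
    x                      ∎

a/2≡a*½ : ∀ a → + a ℚ./ 2 ≡ ℕ→ℚ a ℚ.* ½
a/2≡a*½ a = trans (double (+ a ℚ./ 2)) (cong (ℚ._* ½) (a/n*n≡a a 1))
  where
  double : ∀ x → x ≡ x ℚ.* ℕ→ℚ 2 ℚ.* ½
  double x = begin
    x                      ≡⟨ ℚP.*-identityʳ x ⟨
    x ℚ.* 1ℚ               ≡⟨ cong (x ℚ.*_) ½*2≡1 ⟨
    x ℚ.* (½ ℚ.* ℕ→ℚ 2)   ≡⟨ solve (x ∷ []) ℚ-ring ⟩
    x ℚ.* ℕ→ℚ 2 ℚ.* ½     ∎

lucas-suc-halved : ∀ m → (ℕ→ℚ (lucas m) ℚ.+ ℕ→ℚ 5 ℚ.* ℕ→ℚ (fib m)) ℚ.* ½ ℚ.* ½ ≡ ℕ→ℚ (lucas (suc m)) ℚ.* ½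
lucas-suc-halved m = begin
  (ℕ→ℚ (lucas m) ℚ.+ ℕ→ℚ 5 ℚ.* ℕ→ℚ (fib m)) ℚ.* ½ ℚ.* ½
    ≡⟨ cong (λ x → x ℚ.* ½ ℚ.* ½) (trans (ℕ→ℚ-+ (lucas m) (5 ℕ.* fib m)) (cong (ℕ→ℚ (lucas m) ℚ.+_) (ℕ→ℚ-* 5 (fib m)))) ⟨
  ℕ→ℚ (lucas m ℕ.+ 5 ℕ.* fib m) ℚ.* ½ ℚ.* ½
    ≡⟨ cong (λ x → ℕ→ℚ x ℚ.* ½ ℚ.* ½) (proj₂ (fib-lucas-suc m)) ⟨
  ℕ→ℚ (2 ℕ.* lucas (suc m)) ℚ.* ½ ℚ.* ½
    ≡⟨ cong (ℚ._* ½) (ℕ→ℚ[2*n]*½≡ℕ→ℚn (lucas (suc m))) ⟩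
  ℕ→ℚ (lucas (suc m)) ℚ.* ½
    ∎

fib-suc-halved : ∀ m → (ℕ→ℚ (lucas m) ℚ.+ ℕ→ℚ (fib m)) ℚ.* ½ ℚ.* ½ ≡ ℕ→ℚ (fib (suc m)) ℚ.* ½
fib-suc-halved m = begin
  (ℕ→ℚ (lucas m) ℚ.+ ℕ→ℚ (fib m)) ℚ.* ½ ℚ.* ½
    ≡⟨ cong (λ x → x ℚ.* ½ ℚ.* ½) (ℕ→ℚ-+ (lucas m) (fib m)) ⟨
  ℕ→ℚ (lucas m ℕ.+ fib m) ℚ.* ½ ℚ.* ½
    ≡⟨ cong (λ x → ℕ→ℚ x ℚ.* ½ ℚ.* ½) (proj₁ (fib-lucas-suc m)) ⟨
  ℕ→ℚ (2 ℕ.* fib (suc m)) ℚ.* ½ ℚ.* ½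
    ≡⟨ cong (ℚ._* ½) (ℕ→ℚ[2*n]*½≡ℕ→ℚn (fib (suc m))) ⟩
  ℕ→ℚ (fib (suc m)) ℚ.* ½
    ∎

φ ψ : ℚ√5
φ = ½ + ½ √5
ψ = ½ + ℚ.- ½ √5

binet-φ : ∀ m → φ ^√5 m ≡ (ℕ→ℚ (lucas m) ℚ.* ½) + (ℕ→ℚ (fib m) ℚ.* ½) √5
binet-φ zero    = refl
binet-φ (suc m) = trans (cong (φ ⊗_) (binet-φ m)) (cong₂ _+_√5 (lucas-step m) (fib-step m))
  where
  lucas-step : ∀ m → ½ ℚ.* (ℕ→ℚ (lucas m) ℚ.* ½) ℚ.+ ℕ→ℚ 5 ℚ.* (½ ℚ.* (ℕ→ℚ (fib m) ℚ.* ½))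
                   ≡ ℕ→ℚ (lucas (suc m)) ℚ.* ½
  lucas-step m = trans (regroup (ℕ→ℚ (lucas m)) (ℕ→ℚ (fib m))) (lucas-suc-halved m)
    where
    regroup : ∀ x y → ½ ℚ.* (x ℚ.* ½) ℚ.+ ℕ→ℚ 5 ℚ.* (½ ℚ.* (y ℚ.* ½)) ≡ (x ℚ.+ ℕ→ℚ 5 ℚ.* y) ℚ.* ½ ℚ.* ½
    regroup x y = solve (x ∷ y ∷ []) ℚ-ring
  fib-step : ∀ m → ½ ℚ.* (ℕ→ℚ (fib m) ℚ.* ½) ℚ.+ ½ ℚ.* (ℕ→ℚ (lucas m) ℚ.* ½) ≡ ℕ→ℚ (fib (suc m)) ℚ.* ½
  fib-step m = trans (regroup (ℕ→ℚ (lucas m)) (ℕ→ℚ (fib m))) (fib-suc-halved m)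
    where
    regroup : ∀ x y → ½ ℚ.* (y ℚ.* ½) ℚ.+ ½ ℚ.* (x ℚ.* ½) ≡ (x ℚ.+ y) ℚ.* ½ ℚ.* ½
    regroup x y = solve (x ∷ y ∷ []) ℚ-ring

binet-ψ : ∀ m → ψ ^√5 m ≡ (ℕ→ℚ (lucas m) ℚ.* ½) + ℚ.- (ℕ→ℚ (fib m) ℚ.* ½) √5
binet-ψ zero    = refl
binet-ψ (suc m) = trans (cong (ψ ⊗_) (binet-ψ m)) (cong₂ _+_√5 lucas-step fib-step)
  where
  lucas-step : ½ ℚ.* (ℕ→ℚ (lucas m) ℚ.* ½) ℚ.+ ℕ→ℚ 5 ℚ.* (ℚ.- ½ ℚ.* ℚ.- (ℕ→ℚ (fib m) ℚ.* ½))
             ≡ ℕ→ℚ (lucas (suc m)) ℚ.* ½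
  lucas-step = trans (regroup (ℕ→ℚ (lucas m)) (ℕ→ℚ (fib m))) (lucas-suc-halved m)
    where
    regroup : ∀ x y → ½ ℚ.* (x ℚ.* ½) ℚ.+ ℕ→ℚ 5 ℚ.* (ℚ.- ½ ℚ.* ℚ.- (y ℚ.* ½)) ≡ (x ℚ.+ ℕ→ℚ 5 ℚ.* y) ℚ.* ½ ℚ.* ½
    regroup x y = solve (x ∷ y ∷ []) ℚ-ring
  fib-step : ½ ℚ.* ℚ.- (ℕ→ℚ (fib m) ℚ.* ½) ℚ.+ ℚ.- ½ ℚ.* (ℕ→ℚ (lucas m) ℚ.* ½) ≡ ℚ.- (ℕ→ℚ (fib (suc m)) ℚ.* ½)
  fib-step = trans (regroup (ℕ→ℚ (lucas m)) (ℕ→ℚ (fib m))) (cong ℚ.-_ (fib-suc-halved m))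
    where
    regroup : ∀ x y → ½ ℚ.* ℚ.- (y ℚ.* ½) ℚ.+ ℚ.- ½ ℚ.* (x ℚ.* ½) ≡ ℚ.- ((x ℚ.+ y) ℚ.* ½ ℚ.* ½)
    regroup x y = solve (x ∷ y ∷ []) ℚ-ring

√5*fib≡φ^-ψ^ : ∀ m → embed (ℕ→ℚ (fib m)) ⊗ sqrt5 ≡ φ ^√5 m ⊕ ⊖ ψ ^√5 m
√5*fib≡φ^-ψ^ m = begin
  embed (ℕ→ℚ (fib m)) ⊗ sqrt5
    ≡⟨ cong₂ _+_√5 (re-part (ℕ→ℚ (fib m)) (ℕ→ℚ (lucas m))) (im-part (ℕ→ℚ (fib m))) ⟩
  (ℕ→ℚ (lucas m) ℚ.* ½ ℚ.+ ℚ.- (ℕ→ℚ (lucas m) ℚ.* ½)) + (ℕ→ℚ (fib m) ℚ.* ½ ℚ.+ ℚ.- ℚ.- (ℕ→ℚ (fib m) ℚ.* ½)) √5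
    ≡⟨ cong₂ (λ x y → x ⊕ ⊖ y) (binet-φ m) (binet-ψ m) ⟨
  φ ^√5 m ⊕ ⊖ ψ ^√5 m
    ∎
  where
  re-part : ∀ f l → f ℚ.* 0ℚ ℚ.+ ℕ→ℚ 5 ℚ.* (0ℚ ℚ.* 1ℚ) ≡ l ℚ.* ½ ℚ.+ ℚ.- (l ℚ.* ½)
  re-part f l = solve (f ∷ l ∷ []) ℚ-ring
  im-part : ∀ f → f ℚ.* 1ℚ ℚ.+ 0ℚ ℚ.* 0ℚ ≡ f ℚ.* ½ ℚ.+ ℚ.- ℚ.- (f ℚ.* ½)
  im-part f = solve (f ∷ []) ℚ-ring

√5⁻¹ : ℚ√5
√5⁻¹ = 0ℚ + (+ 1 ℚ./ 5) √5

sqrt5-⊗-cancelˡ : ∀ {x y} → sqrt5 ⊗ x ≡ sqrt5 ⊗ y → x ≡ y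
sqrt5-⊗-cancelˡ {x} {y} √5x≡√5y = begin
  x                      ≡⟨ ⊗-identityˡ x ⟨
  one√5 ⊗ x              ≡⟨ cong (_⊗ x) {one√5} {√5⁻¹ ⊗ sqrt5} refl ⟩
  √5⁻¹ ⊗ sqrt5 ⊗ x       ≡⟨ ⊗-assoc √5⁻¹ sqrt5 x ⟩
  √5⁻¹ ⊗ (sqrt5 ⊗ x)     ≡⟨ cong (√5⁻¹ ⊗_) √5x≡√5y ⟩
  √5⁻¹ ⊗ (sqrt5 ⊗ y)     ≡⟨ ⊗-assoc √5⁻¹ sqrt5 y ⟨
  √5⁻¹ ⊗ sqrt5 ⊗ y       ≡⟨ cong (_⊗ y) {√5⁻¹ ⊗ sqrt5} {one√5} refl ⟩
  one√5 ⊗ y              ≡⟨ ⊗-identityˡ y ⟩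
  y                      ∎

module _ (j : ℕ) where

  X β : ℚ√5
  X = ℕ→ℚ (fib (2 ℕ.* j)) • sqrt5
  β = ψ ^√5 (2 ℕ.* j)

  β⊕X≡φ^2j : β ⊕ X ≡ φ ^√5 (2 ℕ.* j)
  β⊕X≡φ^2j = begin
    β ⊕ X                                  ≡⟨ cong (β ⊕_) (•≡embed-⊗ (ℕ→ℚ (fib (2 ℕ.* j))) sqrt5) ⟩
    β ⊕ embed (ℕ→ℚ (fib (2 ℕ.* j))) ⊗ sqrt5 ≡⟨ cong (β ⊕_) (√5*fib≡φ^-ψ^ (2 ℕ.* j)) ⟩
    β ⊕ (φ ^√5 (2 ℕ.* j) ⊕ ⊖ β)             ≡⟨ cancel β (φ ^√5 (2 ℕ.* j)) ⟩
    φ ^√5 (2 ℕ.* j)                         ∎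
    where
    cancel : ∀ x y → x ⊕ (y ⊕ ⊖ x) ≡ y
    cancel x y = solve (x ∷ y ∷ []) ℚ√5-ring

  √5⊗lhs-term : ∀ n k →
    sqrt5 ⊗ ((ℕ→ℚ (n C k) ℚ.* ℕ→ℚ (fib (2 ℕ.* k ℕ.* j)) ℚ.* bernoulli (n ℕ.∸ k)) • X ^√5 (n ℕ.∸ k))
      ≡ bernoulliPolyCoeff n k ⊗ (X ^√5 (n ℕ.∸ k) ⊗ ((β ⊕ X) ^√5 k ⊕ ⊖ β ^√5 k))
  √5⊗lhs-term n k = begin
    sqrt5 ⊗ ((c ℚ.* F ℚ.* bernoulli (n ℕ.∸ k)) • Y)
      ≡⟨ cong (sqrt5 ⊗_) (•≡embed-⊗ (c ℚ.* F ℚ.* bernoulli (n ℕ.∸ k)) Y) ⟩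
    sqrt5 ⊗ (embed (c ℚ.* F ℚ.* bernoulli (n ℕ.∸ k)) ⊗ Y)
      ≡⟨ cong (λ e → sqrt5 ⊗ (e ⊗ Y)) (trans (embed-* (c ℚ.* F) (bernoulli (n ℕ.∸ k)))
                                             (cong (_⊗ B√5 (n ℕ.∸ k)) (embed-* c F))) ⟩
    sqrt5 ⊗ (n C√5 k ⊗ embed F ⊗ B√5 (n ℕ.∸ k) ⊗ Y)
      ≡⟨ rearrange sqrt5 (n C√5 k) (embed F) (B√5 (n ℕ.∸ k)) Y ⟩
    bernoulliPolyCoeff n k ⊗ (Y ⊗ (embed F ⊗ sqrt5))
      ≡⟨ cong (λ z → bernoulliPolyCoeff n k ⊗ (Y ⊗ z)) (√5*fib≡φ^-ψ^ (2 ℕ.* k ℕ.* j)) ⟩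
    bernoulliPolyCoeff n k ⊗ (Y ⊗ (φ ^√5 (2 ℕ.* k ℕ.* j) ⊕ ⊖ ψ ^√5 (2 ℕ.* k ℕ.* j)))
      ≡⟨ cong (λ e → bernoulliPolyCoeff n k ⊗ (Y ⊗ (φ ^√5 e ⊕ ⊖ ψ ^√5 e))) (2kj≡2jk k j) ⟩
    bernoulliPolyCoeff n k ⊗ (Y ⊗ (φ ^√5 (2 ℕ.* j ℕ.* k) ⊕ ⊖ ψ ^√5 (2 ℕ.* j ℕ.* k)))
      ≡⟨ cong₂ (λ a b → bernoulliPolyCoeff n k ⊗ (Y ⊗ (a ⊕ ⊖ b)))
               (trans (cong (_^√5 k) β⊕X≡φ^2j) (^√5-*-assoc φ (2 ℕ.* j) k)) (^√5-*-assoc ψ (2 ℕ.* j) k) ⟨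
    bernoulliPolyCoeff n k ⊗ (Y ⊗ ((β ⊕ X) ^√5 k ⊕ ⊖ β ^√5 k))
      ∎
    where
    c = ℕ→ℚ (n C k)
    F = ℕ→ℚ (fib (2 ℕ.* k ℕ.* j))
    Y = X ^√5 (n ℕ.∸ k)
    rearrange : ∀ s c f b y → s ⊗ (c ⊗ f ⊗ b ⊗ y) ≡ c ⊗ b ⊗ (y ⊗ (f ⊗ s))
    rearrange s c f b y = solve (s ∷ c ∷ f ∷ b ∷ y ∷ []) ℚ√5-ring
    2kj≡2jk : ∀ k j → 2 ℕ.* k ℕ.* j ≡ 2 ℕ.* j ℕ.* k
    2kj≡2jk = ℕ-solve

  √5⊗lhs : ∀ m → sqrt5 ⊗ lhs (suc m) j ≡ embed (ℕ→ℚ (suc m)) ⊗ (X ⊗ β ^√5 m)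
  √5⊗lhs m = begin
    sqrt5 ⊗ lhs (suc m) j
      ≡⟨ ⊗-distribˡ-sum√5 (suc m) sqrt5 _ ⟩
    sum√5 (suc m) (λ k → sqrt5 ⊗ ((ℕ→ℚ (suc m C k) ℚ.* ℕ→ℚ (fib (2 ℕ.* k ℕ.* j)) ℚ.* bernoulli (suc m ℕ.∸ k)) • X ^√5 (suc m ℕ.∸ k)))
      ≡⟨ sum√5-cong (suc m) (λ k _ → √5⊗lhs-term (suc m) k) ⟩
    sum√5 (suc m) (λ k → bernoulliPolyCoeff (suc m) k ⊗ (X ^√5 (suc m ℕ.∸ k) ⊗ ((β ⊕ X) ^√5 k ⊕ ⊖ β ^√5 k)))
      ≡⟨ bernoulli-difference β X m ⟩
    embed (ℕ→ℚ (suc m)) ⊗ (X ⊗ β ^√5 m)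
      ∎

  rhs-as-product : ∀ m → rhs (suc m) j ≡ embed (ℕ→ℚ (suc m) ℚ.* ℕ→ℚ (fib (2 ℕ.* j))) ⊗ ψ ^√5 (2 ℕ.* j ℕ.* m)
  rhs-as-product m = begin
    ((+ suc m ℚ./ 2) ℚ.* F) • (L + ℚ.- F′ √5)
      ≡⟨ cong (λ h → (h ℚ.* F) • (L + ℚ.- F′ √5)) (a/2≡a*½ (suc m)) ⟩
    (ℕ→ℚ (suc m) ℚ.* ½ ℚ.* F) • (L + ℚ.- F′ √5)
      ≡⟨ cong₂ _+_√5 (re-part (ℕ→ℚ (suc m)) F L) (im-part (ℕ→ℚ (suc m)) F F′) ⟩
    (ℕ→ℚ (suc m) ℚ.* F) • ((L ℚ.* ½) + ℚ.- (F′ ℚ.* ½) √5)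
      ≡⟨ •≡embed-⊗ (ℕ→ℚ (suc m) ℚ.* F) ((L ℚ.* ½) + ℚ.- (F′ ℚ.* ½) √5) ⟩
    embed (ℕ→ℚ (suc m) ℚ.* F) ⊗ ((L ℚ.* ½) + ℚ.- (F′ ℚ.* ½) √5)
      ≡⟨ cong (embed (ℕ→ℚ (suc m) ℚ.* F) ⊗_) (binet-ψ (2 ℕ.* j ℕ.* m)) ⟨
    embed (ℕ→ℚ (suc m) ℚ.* F) ⊗ ψ ^√5 (2 ℕ.* j ℕ.* m)
      ∎
    where
    F = ℕ→ℚ (fib (2 ℕ.* j))
    L = ℕ→ℚ (lucas (2 ℕ.* j ℕ.* m))
    F′ = ℕ→ℚ (fib (2 ℕ.* j ℕ.* m))
    re-part : ∀ n f l → n ℚ.* ½ ℚ.* f ℚ.* l ≡ n ℚ.* f ℚ.* (l ℚ.* ½)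
    re-part n f l = solve (n ∷ f ∷ l ∷ []) ℚ-ring
    im-part : ∀ n f g → n ℚ.* ½ ℚ.* f ℚ.* ℚ.- g ≡ n ℚ.* f ℚ.* ℚ.- (g ℚ.* ½)
    im-part n f g = solve (n ∷ f ∷ g ∷ []) ℚ-ring

corollary4 : (n j : ℕ) → 1 ≤ j → lhs n j ≡ rhs n j
corollary4 zero    j _ = refl
corollary4 (suc m) j _ = sqrt5-⊗-cancelˡ (begin
  sqrt5 ⊗ lhs (suc m) j
    ≡⟨ √5⊗lhs j m ⟩
  N ⊗ (X j ⊗ β j ^√5 m)
    ≡⟨ cong₂ (λ x y → N ⊗ (x ⊗ y)) (•≡embed-⊗ F sqrt5) (^√5-*-assoc ψ (2 ℕ.* j) m) ⟩
  N ⊗ (embed F ⊗ sqrt5 ⊗ ψ ^√5 (2 ℕ.* j ℕ.* m))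
    ≡⟨ rearrange N (embed F) sqrt5 (ψ ^√5 (2 ℕ.* j ℕ.* m)) ⟩
  sqrt5 ⊗ (N ⊗ embed F ⊗ ψ ^√5 (2 ℕ.* j ℕ.* m))
    ≡⟨ cong (λ e → sqrt5 ⊗ (e ⊗ ψ ^√5 (2 ℕ.* j ℕ.* m))) (embed-* (ℕ→ℚ (suc m)) F) ⟨
  sqrt5 ⊗ (embed (ℕ→ℚ (suc m) ℚ.* F) ⊗ ψ ^√5 (2 ℕ.* j ℕ.* m))
    ≡⟨ cong (sqrt5 ⊗_) (rhs-as-product j m) ⟨
  sqrt5 ⊗ rhs (suc m) j
    ∎)
  where
  N = embed (ℕ→ℚ (suc m))
  F = ℕ→ℚ (fib (2 ℕ.* j))
  rearrange : ∀ n f s p → n ⊗ (f ⊗ s ⊗ p) ≡ s ⊗ (n ⊗ f ⊗ p)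
  rearrange n f s p = solve (n ∷ f ∷ s ∷ p ∷ []) ℚ√5-ring
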